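{- Let $X$ be a finite pure $d$-dimensional simplicial complex, $0\le i<d$, and $0<\eta<1$. Then for every $i$-cochain $W\subseteq X(i)$ and every $1\le k\le i+1$, $$\Pr\big[P_k\in F^k(W)\wedge P_{k-1}\notin F^{k-1}(W)\big]\le k\,\Pr\big[P_k\in F^k(W)\wedge P_{k-2}\notin S^{k-2}(W)\big].$$
   Context: A simplicial complex $X$ on a finite vertex set is a family of subsets (faces) closed under taking subsets; it contains $\emptyset$. A face $\sigma$ has dimension $|\sigma|-1$; $X(i)$ is the set of $i$-faces, $X(-1)=\{\emptyset\}$. $X$ is $d$-dimensional if its maximal face dimension is $d$, pure if every face lies in a $d$-face. $\deg(\sigma)$ is the number of $d$-faces containing $\sigma$. Random faces: $P_d$ is a uniformly random $d$-face, and for $m=d-1,\dots,-1$, $P_m$ is obtained from $P_{m+1}$ by deleting a uniformly random vertex (independently). For $U\subseteq X(m)$, $\|U\|=\Pr[P_m\in U]$. The link of $\sigma$ is $X_\sigma=\{\tau\setminus\sigma:\tau\in X,\tau\supseteq\sigma\}$ and $\|\cdot\|_\sigma$ is the analogous norm inside $X_\sigma$ (degrees = numbers of top faces of $X_\sigma$). For $U\subseteq X(m)$ and a face $\sigma$ of dimension $<m$, $U_\sigma=\{\tau\in X_\sigma:\tau\sqcup\sigma\in U\}$. Fat faces (fatness constant $\eta$): $S^i(W)=W$, and for $-1\le j<i$, $S^j(W)=\{\sigma\in X(j):\|S^{j+1}(W)_\sigma\|_\sigma\ge\eta^{2^{i-j-1}}\}$. Full faces: for $0\le j\le i+1$, $F^j(W)=\{\tau\in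 X(j):\text{every }(j-1)\text{ -dimensional face }\sigma\subset\tau\text{ lies in }S^{j-1}(W)\}$.
   Formalization: The fatness constant η is taken in the rationals strictly between 0 and 1. -}

module Defs where

open import Data.Bool using (Bool; true; false; _∧_; not; if_then_else_)
open import Data.Nat as ℕ using (ℕ; zero; suc; _∸_; _≡ᵇ_)
open import Data.Fin using (Fin)
open import Data.Fin.Subset using (Subset; _∩_; _∪_; _-_; ∣_∣)
open import Data.Vec using (Vec; []; _∷_; lookup)
open import Data.List as List using (List; []; _∷_; _++_; map; concatMap; filter; length; allFin)
open import Data.Product using (_×_; _,_)
open import Data.Integer using (+_)
open import Data.Rational using (ℚ; _/_; _+_; _*_; 0ℚ; 1ℚ; _≤ᵇ_)
open import Relation.Nullary.Decidable using (T?)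
open import Relation.Binary.PropositionalEquality using (_≡_)

-- Faces are subsets of the vertex set Fin n; a family of faces
-- (a complex, a cochain, S^j(W), F^j(W), ...) is a Boolean predicate.
-- Dimensions are encoded by SIZES: a face of dimension m has size m+1.

Family : ℕ → Set
Family n = Subset n → Bool

allSubsets : (n : ℕ) → List (Subset n)
allSubsets zero    = [] ∷ []
allSubsets (suc n) = map (true ∷_) (allSubsets n) ++ map (false ∷_) (allSubsets n)

vertices : ∀ {n} → Subset n → List (Fin n)
vertices {n} s = filter (λ v → T? (lookup s v)) (allFin n)

deletions : ∀ {n} → Subset n → List (Subset n)
deletions s = map (s -_) (vertices s)

facesOfSize : ∀ {n} → Family n → ℕ → List (Subset n)
facesOfSize {n} Y t = filter (λ s → T? (Y s ∧ (∣ s ∣ ≡ᵇ t))) (allSubsets n)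

Dist : Set → Set
Dist A = List (A × ℚ)

uniform : ∀ {A : Set} → List A → Dist A
uniform []         = []
uniform xs@(_ ∷ _) = map (λ x → x , ((+ 1) / length xs)) xs

bind : ∀ {A B : Set} → Dist A → (A → Dist B) → Dist B
bind μ f = concatMap (λ { (a , p) → map (λ { (b , q) → b , p * q }) (f a) }) μ

Pr : ∀ {A : Set} → Dist A → (A → Bool) → ℚ
Pr []             E = 0ℚ
Pr ((a , p) ∷ μ) E = (if E a then p else 0ℚ) + Pr μ E

-- The random walk P_top, P_{top-1}, ... , P_{-1} in a complex Y whose
-- top faces have size T (i.e. dimension T-1).  A sample is the chain
-- (P_{T-1} ∷ P_{T-2} ∷ ... ∷ P_{-1}), each face obtained from the
-- previous one by deleting a uniformly random vertex.

chainFrom : ∀ {n} → ℕ → Subset n → Dist (List (Subset n))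
chainFrom zero    σ = ((σ ∷ []) , 1ℚ) ∷ []
chainFrom (suc r) σ =
  bind (uniform (deletions σ)) (λ τ → map (λ { (c , p) → (σ ∷ c) , p }) (chainFrom r τ))

process : ∀ {n} → Family n → (T : ℕ) → Dist (List (Subset n))
process Y T = bind (uniform (facesOfSize Y T)) (chainFrom T)

nth : ∀ {A : Set} → A → ℕ → List A → A
nth a _       []       = a
nth a zero    (x ∷ _)  = x
nth a (suc k) (_ ∷ xs) = nth a k xs

-- P at size s (the face P_{s-1}) in a chain of a complex with top size T
Pat : ∀ {n} → (T s : ℕ) → List (Subset n) → Subset n
Pat T s ω = nth Data.Fin.Subset.⊥ (T ∸ s) ω

-- ‖U‖ = Pr[P_{s-1} ∈ U], for U a family of faces of size s, in complex Y
-- with top size T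
norm : ∀ {n} → Family n → (T s : ℕ) → Family n → ℚ
norm Y T s U = Pr (process Y T) (λ ω → U (Pat T s ω))

disjoint : ∀ {n} → Subset n → Subset n → Bool
disjoint τ σ = ∣ τ ∩ σ ∣ ≡ᵇ 0

-- X_σ = { τ ∖ σ : τ ∈ X, τ ⊇ σ } = { τ : τ ∩ σ = ∅, τ ∪ σ ∈ X }
link : ∀ {n} → Family n → Subset n → Family n
link X σ τ = disjoint τ σ ∧ X (τ ∪ σ)

restrict : ∀ {n} → Family n → Family n → Subset n → Family n
restrict X U σ τ = link X σ τ ∧ U (τ ∪ σ)

allB : ∀ {A : Set} → (A → Bool) → List A → Bool
allB p []       = true
allB p (x ∷ xs) = p x ∧ allB p xs

_^ℚ_ : ℚ → ℕ → ℚ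
q ^ℚ zero  = 1ℚ
q ^ℚ suc m = q * (q ^ℚ m)

-- X has top size d+1, W ⊆ X(i) (faces of size i+1).
-- fatDepth r = S^{i-r}(W), whose faces have size i+1-r:
--   S^i(W) = W,
--   S^j(W) = { σ ∈ X(j) : ‖S^{j+1}(W)_σ‖_σ ≥ η^(2^(i-j-1)) }.
-- In the link of σ ∈ X(j) (top size (d+1) - (j+1)), S^{j+1}(W)_σ consists
-- of faces of size 1 (vertices).

fatDepth : ∀ {n} → (X : Family n) (d i : ℕ) (η : ℚ) (W : Family n) → ℕ → Family n
fatDepth X d i η W zero    σ = W σ
fatDepth X d i η W (suc r) σ =
  X σ ∧ (∣ σ ∣ ≡ᵇ (i ∸ r)) ∧
  ((η ^ℚ (2 ℕ.^ r)) ≤ᵇ norm (link X σ) (suc d ∸ ∣ σ ∣) 1 (restrict X (fatDepth X d i η W r) σ))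

-- S^j(W) indexed by size t = j+1  (for 0 ≤ t ≤ i+1, i.e. -1 ≤ j ≤ i)
fat : ∀ {n} → (X : Family n) (d i : ℕ) (η : ℚ) (W : Family n) → ℕ → Family n
fat X d i η W t = fatDepth X d i η W (suc i ∸ t)

-- F^j(W) indexed by size t = j+1 (for 1 ≤ t ≤ i+2): faces τ ∈ X(j)
-- all of whose (j-1)-faces lie in S^{j-1}(W)
full : ∀ {n} → (X : Family n) (d i : ℕ) (η : ℚ) (W : Family n) → ℕ → Family n
full X d i η W t τ =
  X τ ∧ (∣ τ ∣ ≡ᵇ t) ∧ allB (fat X d i η W (t ∸ 1)) (deletions τ)

record IsPureComplex {n : ℕ} (X : Family n) (d : ℕ) : Set where
  field
    hasEmpty   : X Data.Fin.Subset.⊥ ≡ true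
    downClosed : ∀ s t → t Data.Fin.Subset.⊆ s → X s ≡ true → X t ≡ true
    topExists  : Data.Product.∃ λ s → X s ≡ true × ∣ s ∣ ≡ suc d
    dimBound   : ∀ s → X s ≡ true → ∣ s ∣ ℕ.≤ suc d
    pure       : ∀ s → X s ≡ true →
                 Data.Product.∃ λ t → X t ≡ true × ∣ t ∣ ≡ suc d × s Data.Fin.Subset.⊆ t

IsCochain : ∀ {n} → Family n → ℕ → Family n → Set
IsCochain X i W = ∀ s → W s ≡ true → X s ≡ true × ∣ s ∣ ≡ suc i

-- Condition on the walk up to P_k ∈ F^k(W).  If the facet P_{k-1} is not
-- full, it is nevertheless a (k-1)-face of X (X is closed downwards), so one
-- of its k facets lies outside S^{k-2}(W); the uniformly random facet P_{k-2}
-- hits it with probability at least 1/k.  Summing over the walk gives the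
-- factor k.
module Submission where

open import Defs
open import Data.Bool using (Bool; true; false; _∧_; not; if_then_else_)
open import Data.Bool.Properties using (∧-conicalˡ; ∧-conicalʳ; T-≡)
open import Data.Nat using (ℕ; suc; zero; _≤_; _<_; s≤s; z≤n; _+_; _∸_; _≡ᵇ_)
import Data.Nat.Properties as ℕ
open import Data.Integer using (+_)
import Data.Integer as ℤ
open import Data.Integer.Solver using (module +-*-Solver)
open import Data.Rational using (ℚ; 0ℚ; 1ℚ; _/_; _*_) renaming (_<_ to _<ℚ_; _≤_ to _≤ℚ_)
import Data.Rational as ℚ
import Data.Rational.Properties as ℚ
import Data.Rational.Unnormalised as ℚᵘ
import Data.Rational.Unnormalised.Properties as ℚᵘ
open import Data.Fin using (Fin; zero; suc)
open import Data.Fin.Subset using (Subset; ∣_∣; ⁅_⁆; _─_; ⊥; _⊆_)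
import Data.Fin.Subset.Properties as Subset
open import Data.Vec using (_∷_; lookup) renaming ([] to []ᵥ)
open import Data.List using (List; []; _∷_; _++_; map; length; tabulate; filter; allFin)
import Data.List.Properties as List
open import Data.List.Membership.Propositional using (_∈_)
open import Data.List.Membership.Propositional.Properties using (∈-map⁻; ∈-filter⁻)
open import Data.List.Relation.Unary.All using (All; []; _∷_)
open import Data.List.Relation.Unary.Any using (here; there)
open import Data.Product using (_×_; _,_; proj₁; proj₂; ∃-syntax)
open import Function using (Equivalence)
open import Relation.Nullary.Decidable using (T?)
open import Relation.Binary.PropositionalEquality

private
  variable
    A B : Set
    n : ℕ


private
  toℚᵘ-/1 : ∀ k → ℚ.toℚᵘ ((+ k) / 1) ℚᵘ.≃ ℚᵘ.mkℚᵘ (+ k) 0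
  toℚᵘ-/1 k = ℚ.toℚᵘ-fromℚᵘ (ℚᵘ.mkℚᵘ (+ k) 0)

1+[k/1]≡[1+k]/1 : ∀ k → 1ℚ ℚ.+ (+ k) / 1 ≡ (+ suc k) / 1
1+[k/1]≡[1+k]/1 k = ℚ.toℚᵘ-injective (begin
  ℚ.toℚᵘ (1ℚ ℚ.+ (+ k) / 1)       ≈⟨ ℚ.toℚᵘ-homo-+ 1ℚ ((+ k) / 1) ⟩
  ℚᵘ.1ℚᵘ ℚᵘ.+ ℚ.toℚᵘ ((+ k) / 1)  ≈⟨ ℚᵘ.+-congʳ ℚᵘ.1ℚᵘ (toℚᵘ-/1 k) ⟩
  ℚᵘ.1ℚᵘ ℚᵘ.+ ℚᵘ.mkℚᵘ (+ k) 0     ≈⟨ ℚᵘ.*≡* (solve 1 (λ x → (con (+ 1) :* con (+ 1) :+ x :* con (+ 1)) :* con (+ 1)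
                                                         := (con (+ 1) :+ x) :* (con (+ 1) :* con (+ 1))) refl (+ k)) ⟩
  ℚᵘ.mkℚᵘ (+ suc k) 0             ≈⟨ ℚᵘ.≃-sym (toℚᵘ-/1 (suc k)) ⟩
  ℚ.toℚᵘ ((+ suc k) / 1)          ∎)
  where open ℚᵘ.≃-Reasoning; open +-*-Solver

[1+k]/1*1/[1+k]≡1 : ∀ k → (+ suc k) / 1 * ((+ 1) / suc k) ≡ 1ℚ
[1+k]/1*1/[1+k]≡1 k = ℚ.toℚᵘ-injective (begin
  ℚ.toℚᵘ ((+ suc k) / 1 * ((+ 1) / suc k))   ≈⟨ ℚ.toℚᵘ-homo-* ((+ suc k) / 1) ((+ 1) / suc k) ⟩
  ℚ.toℚᵘ ((+ suc k) / 1) ℚᵘ.* ℚ.toℚᵘ ((+ 1) / suc k)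
    ≈⟨ ℚᵘ.*-cong (toℚᵘ-/1 (suc k)) (ℚ.toℚᵘ-fromℚᵘ (ℚᵘ.mkℚᵘ (+ 1) k)) ⟩
  ℚᵘ.mkℚᵘ (+ suc k) 0 ℚᵘ.* ℚᵘ.mkℚᵘ (+ 1) k  ≈⟨ ℚᵘ.*≡* (trans (solve 1 (λ x → ((con (+ 1) :+ x) :* con (+ 1)) :* con (+ 1)
                                                                  := con (+ 1) :* (con (+ 1) :+ x)) refl (+ k))
                                                          (cong (λ z → + 1 ℤ.* + suc z) (sym (ℕ.+-identityʳ k)))) ⟩
  ℚᵘ.1ℚᵘ                                     ∎)
  where open ℚᵘ.≃-Reasoning; open +-*-Solver

k/1-nonNeg : ∀ k → 0ℚ ≤ℚ (+ k) / 1
k/1-nonNeg k = ℚ.nonNegative⁻¹ _ {{ℚ.normalize-nonNeg k 1}}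


𝔼 : Dist A → (A → ℚ) → ℚ
𝔼 []            g = 0ℚ
𝔼 ((a , p) ∷ μ) g = p * g a ℚ.+ 𝔼 μ g

∑ : (A → ℚ) → List A → ℚ
∑ g []       = 0ℚ
∑ g (x ∷ xs) = g x ℚ.+ ∑ g xs

SupportedOn : (A → Set) → Dist A → Set
SupportedOn P μ = All (λ x → 0ℚ ≤ℚ proj₂ x × P (proj₁ x)) μ

𝔼-cong : (μ : Dist A) {g h : A → ℚ} → (∀ a → g a ≡ h a) → 𝔼 μ g ≡ 𝔼 μ h
𝔼-cong []            eq = refl
𝔼-cong ((a , p) ∷ μ) eq = cong₂ (λ x r → p * x ℚ.+ r) (eq a) (𝔼-cong μ eq)

Pr-false : (μ : Dist A) → Pr μ (λ _ → false) ≡ 0ℚ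
Pr-false []            = refl
Pr-false ((a , p) ∷ μ) = trans (ℚ.+-identityˡ _) (Pr-false μ)

Pr-++ : (μ ν : Dist A) (E : A → Bool) → Pr (μ ++ ν) E ≡ Pr μ E ℚ.+ Pr ν E
Pr-++ []            ν E = sym (ℚ.+-identityˡ _)
Pr-++ ((a , p) ∷ μ) ν E =
  trans (cong ((if E a then p else 0ℚ) ℚ.+_) (Pr-++ μ ν E)) (sym (ℚ.+-assoc (if E a then p else 0ℚ) (Pr μ E) (Pr ν E)))

-- The rescaling maps in bind and chainFrom are anonymous pattern lambdas,
-- so they are characterised by their action rather than named.
Pr-map-rescale : ∀ (p : ℚ) (h : A × ℚ → A × ℚ) → (∀ a q → h (a , q) ≡ (a , p * q)) →
                 ∀ μ E → Pr (map h μ) E ≡ p * Pr μ E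
Pr-map-rescale p h h≗ []            E = sym (ℚ.*-zeroʳ p)
Pr-map-rescale p h h≗ ((a , q) ∷ μ) E rewrite h≗ a q with E a
... | true  = trans (cong (p * q ℚ.+_) (Pr-map-rescale p h h≗ μ E)) (sym (ℚ.*-distribˡ-+ p q _))
... | false = trans (ℚ.+-identityˡ _) (trans (Pr-map-rescale p h h≗ μ E) (cong (p *_) (sym (ℚ.+-identityˡ _))))

Pr-map-cons : ∀ (σ : A) (h : List A × ℚ → List A × ℚ) → (∀ c p → h (c , p) ≡ (σ ∷ c , p)) →
              ∀ μ E → Pr (map h μ) E ≡ Pr μ (λ c → E (σ ∷ c))
Pr-map-cons σ h h≗ []            E = refl
Pr-map-cons σ h h≗ ((c , p) ∷ μ) E rewrite h≗ c p = cong ((if E (σ ∷ c) then p else 0ℚ) ℚ.+_) (Pr-map-cons σ h h≗ μ E)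

Pr-bind : (μ : Dist A) (f : A → Dist B) (E : B → Bool) → Pr (bind μ f) E ≡ 𝔼 μ (λ a → Pr (f a) E)
Pr-bind []            f E = refl
Pr-bind ((a , p) ∷ μ) f E = trans (Pr-++ (map _ (f a)) (bind μ f) E)
  (cong₂ ℚ._+_ (Pr-map-rescale p _ (λ _ _ → refl) (f a) E) (Pr-bind μ f E))

𝔼-nonNeg : (μ : Dist A) {g : A → ℚ} → SupportedOn (λ a → 0ℚ ≤ℚ g a) μ → 0ℚ ≤ℚ 𝔼 μ g
𝔼-nonNeg []            []                = ℚ.≤-refl
𝔼-nonNeg ((a , p) ∷ μ) {g} ((0≤p , 0≤ga) ∷ s) =
  ℚ.≤-trans (ℚ.≤-reflexive (sym (ℚ.+-identityˡ 0ℚ)))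
    (ℚ.+-mono-≤ (ℚ.nonNegative⁻¹ (p * g a) {{ℚ.nonNeg*nonNeg⇒nonNeg p {{ℚ.nonNegative 0≤p}} (g a) {{ℚ.nonNegative 0≤ga}}}})
                (𝔼-nonNeg μ s))

𝔼-dominated : (μ : Dist A) {g h : A → ℚ} (c : ℚ) →
              SupportedOn (λ a → g a ≤ℚ c * h a) μ → 𝔼 μ g ≤ℚ c * 𝔼 μ h
𝔼-dominated []            c [] = ℚ.≤-reflexive (sym (ℚ.*-zeroʳ c))
𝔼-dominated ((a , p) ∷ μ) {g} {h} c ((0≤p , ga≤) ∷ s) = begin
  p * g a ℚ.+ 𝔼 μ g              ≤⟨ ℚ.+-mono-≤ (ℚ.*-monoˡ-≤-nonNeg p {{ℚ.nonNegative 0≤p}} ga≤) (𝔼-dominated μ c s) ⟩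
  p * (c * h a) ℚ.+ c * 𝔼 μ h    ≡⟨ cong (ℚ._+ c * 𝔼 μ h) (*-swap p c (h a)) ⟩
  c * (p * h a) ℚ.+ c * 𝔼 μ h    ≡⟨ sym (ℚ.*-distribˡ-+ c (p * h a) (𝔼 μ h)) ⟩
  c * (p * h a ℚ.+ 𝔼 μ h)        ∎
  where
  open ℚ.≤-Reasoning
  *-swap : ∀ x y z → x * (y * z) ≡ y * (x * z)
  *-swap x y z = trans (sym (ℚ.*-assoc x y z)) (trans (cong (_* z) (ℚ.*-comm x y)) (ℚ.*-assoc y x z))

Pr-bind-dominated : (μ : Dist A) (f : A → Dist B) {E F : B → Bool} (c : ℚ) →
                    SupportedOn (λ a → Pr (f a) E ≤ℚ c * Pr (f a) F) μ →
                    Pr (bind μ f) E ≤ℚ c * Pr (bind μ f) F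
Pr-bind-dominated μ f c s = subst₂ (λ x y → x ≤ℚ c * y) (sym (Pr-bind μ f _)) (sym (Pr-bind μ f _))
  (𝔼-dominated μ c s)


uniform-supportedOn : (P : A → Set) (xs : List A) → (∀ x → x ∈ xs → P x) → SupportedOn P (uniform xs)
uniform-supportedOn P []           P-xs = []
uniform-supportedOn P xs@(_ ∷ ys) P-xs = go xs P-xs
  where
  go : ∀ zs → (∀ z → z ∈ zs → P z) → SupportedOn P (map (λ z → z , (+ 1) / suc (length ys)) zs)
  go []       _    = []
  go (z ∷ zs) P-zs = (0≤w , P-zs z (here refl)) ∷ go zs (λ z′ z′∈ → P-zs z′ (there z′∈))
    where
    0≤w : 0ℚ ≤ℚ (+ 1) / suc (length ys)
    0≤w = ℚ.nonNegative⁻¹ _ {{ℚ.normalize-nonNeg 1 (suc (length ys))}}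

𝔼-uniform : ∀ (x : A) xs (g : A → ℚ) → 𝔼 (uniform (x ∷ xs)) g ≡ (+ 1) / suc (length xs) * ∑ g (x ∷ xs)
𝔼-uniform x xs g = go (x ∷ xs)
  where
  w : ℚ
  w = (+ 1) / suc (length xs)
  go : ∀ ys → 𝔼 (map (λ y → y , w) ys) g ≡ w * ∑ g ys
  go []       = sym (ℚ.*-zeroʳ w)
  go (y ∷ ys) = trans (cong (w * g y ℚ.+_) (go ys)) (sym (ℚ.*-distribˡ-+ w (g y) (∑ g ys)))

∑-ones : (g : A → ℚ) (xs : List A) → (∀ x → x ∈ xs → g x ≡ 1ℚ) → ∑ g xs ≡ (+ length xs) / 1
∑-ones g []       _    = refl
∑-ones g (x ∷ xs) g≡1 = trans (cong₂ ℚ._+_ (g≡1 x (here refl)) (∑-ones g xs (λ y y∈ → g≡1 y (there y∈))))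
                               (1+[k/1]≡[1+k]/1 (length xs))

∑-nonNeg : (g : A → ℚ) (xs : List A) → (∀ x → x ∈ xs → 0ℚ ≤ℚ g x) → 0ℚ ≤ℚ ∑ g xs
∑-nonNeg g []       _      = ℚ.≤-refl
∑-nonNeg g (x ∷ xs) 0≤g = ℚ.≤-trans (ℚ.≤-reflexive (sym (ℚ.+-identityˡ 0ℚ)))
  (ℚ.+-mono-≤ (0≤g x (here refl)) (∑-nonNeg g xs (λ y y∈ → 0≤g y (there y∈))))

∑-≥-term : (g : A → ℚ) (xs : List A) → (∀ x → x ∈ xs → 0ℚ ≤ℚ g x) → ∀ {y} → y ∈ xs → g y ≤ℚ ∑ g xs
∑-≥-term g (x ∷ xs) 0≤g (here refl) = ℚ.≤-trans (ℚ.≤-reflexive (sym (ℚ.+-identityʳ (g x))))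
  (ℚ.+-mono-≤ (ℚ.≤-refl {g x}) (∑-nonNeg g xs (λ y y∈ → 0≤g y (there y∈))))
∑-≥-term g (x ∷ xs) 0≤g (there y∈) = ℚ.≤-trans (∑-≥-term g xs (λ y y∈′ → 0≤g y (there y∈′)) y∈)
  (ℚ.≤-trans (ℚ.≤-reflexive (sym (ℚ.+-identityˡ _))) (ℚ.+-mono-≤ (0≤g x (here refl)) ℚ.≤-refl))

𝔼-uniform-ones : (xs : List A) (g : A → ℚ) → 0 < length xs → (∀ x → x ∈ xs → g x ≡ 1ℚ) →
                 𝔼 (uniform xs) g ≡ 1ℚ
𝔼-uniform-ones (x ∷ xs) g _ g≡1 = begin
  𝔼 (uniform (x ∷ xs)) g ≡⟨ 𝔼-uniform x xs g ⟩
  w * ∑ g (x ∷ xs)       ≡⟨ cong (w *_) (∑-ones g (x ∷ xs) g≡1) ⟩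
  w * K                  ≡⟨ ℚ.*-comm w K ⟩
  K * w                  ≡⟨ [1+k]/1*1/[1+k]≡1 (length xs) ⟩
  1ℚ                     ∎
  where
  open ≡-Reasoning
  w : ℚ
  w = (+ 1) / suc (length xs)
  K : ℚ
  K = (+ suc (length xs)) / 1

length*𝔼-uniform : ∀ m (xs : List A) (g : A → ℚ) → length xs ≡ suc m →
                   (+ suc m) / 1 * 𝔼 (uniform xs) g ≡ ∑ g xs
length*𝔼-uniform _ (x ∷ xs) g refl = begin
  K * 𝔼 (uniform (x ∷ xs)) g ≡⟨ cong (K *_) (𝔼-uniform x xs g) ⟩
  K * (w * ∑ g (x ∷ xs))     ≡⟨ sym (ℚ.*-assoc K w (∑ g (x ∷ xs))) ⟩
  K * w * ∑ g (x ∷ xs)       ≡⟨ cong (_* ∑ g (x ∷ xs)) ([1+k]/1*1/[1+k]≡1 (length xs)) ⟩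
  1ℚ * ∑ g (x ∷ xs)          ≡⟨ ℚ.*-identityˡ (∑ g (x ∷ xs)) ⟩
  ∑ g (x ∷ xs)               ∎
  where
  open ≡-Reasoning
  w : ℚ
  w = (+ 1) / suc (length xs)
  K : ℚ
  K = (+ suc (length xs)) / 1


private
  filter-lookup-tabulate-suc : ∀ {k} (f : Fin k → Fin n) b (s : Subset n) →
    filter (λ v → T? (lookup (b ∷ s) v)) (tabulate (λ x → suc (f x)))
      ≡ map suc (filter (λ v → T? (lookup s v)) (tabulate f))
  filter-lookup-tabulate-suc {k = zero}  f b s = refl
  filter-lookup-tabulate-suc {k = suc k} f b s with lookup s (f zero)
  ... | true  = cong (suc (f zero) ∷_) (filter-lookup-tabulate-suc (λ x → f (suc x)) b s)
  ... | false = filter-lookup-tabulate-suc (λ x → f (suc x)) b s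

length-vertices : (s : Subset n) → length (vertices s) ≡ ∣ s ∣
length-vertices []ᵥ          = refl
length-vertices (true ∷ s)  = cong suc (trans (cong length (filter-lookup-tabulate-suc (λ x → x) true s))
                                              (trans (List.length-map suc (vertices s)) (length-vertices s)))
length-vertices (false ∷ s) = trans (cong length (filter-lookup-tabulate-suc (λ x → x) false s))
                                    (trans (List.length-map suc (vertices s)) (length-vertices s))

length-deletions : (s : Subset n) → length (deletions s) ≡ ∣ s ∣
length-deletions s = trans (List.length-map _ (vertices s)) (length-vertices s)

1+∣s-v∣≡∣s∣ : (s : Subset n) (v : Fin n) → lookup s v ≡ true → suc ∣ s ─ ⁅ v ⁆ ∣ ≡ ∣ s ∣
1+∣s-v∣≡∣s∣ (true  ∷ s) zero    refl = cong (λ t → suc ∣ t ∣) (Subset.p─⊥≡p s)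
1+∣s-v∣≡∣s∣ (true  ∷ s) (suc v) v∈s  = cong suc (1+∣s-v∣≡∣s∣ s v v∈s)
1+∣s-v∣≡∣s∣ (false ∷ s) (suc v) v∈s  = 1+∣s-v∣≡∣s∣ s v v∈s

∈-deletions⁻ : (s : Subset n) {τ : Subset n} → τ ∈ deletions s → ∃[ v ] lookup s v ≡ true × τ ≡ s ─ ⁅ v ⁆
∈-deletions⁻ s τ∈ with ∈-map⁻ (s Data.Fin.Subset.-_) τ∈
... | v , v∈ , refl = v , Equivalence.to T-≡ (proj₂ (∈-filter⁻ (λ v → T? (lookup s v)) {xs = allFin _} v∈)) , refl

∈-deletions⇒⊆ : (s : Subset n) {τ : Subset n} → τ ∈ deletions s → τ ⊆ s
∈-deletions⇒⊆ s τ∈ with ∈-deletions⁻ s τ∈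
... | v , _ , refl = Subset.p─q⊆p s ⁅ v ⁆

∈-deletions⇒1+∣τ∣≡∣s∣ : (s : Subset n) {τ : Subset n} → τ ∈ deletions s → suc ∣ τ ∣ ≡ ∣ s ∣
∈-deletions⇒1+∣τ∣≡∣s∣ s τ∈ with ∈-deletions⁻ s τ∈
... | v , v∈s , refl = 1+∣s-v∣≡∣s∣ s v v∈s

allB-false⇒∃ : (p : A → Bool) (xs : List A) → allB p xs ≡ false → ∃[ x ] x ∈ xs × p x ≡ false
allB-false⇒∃ p (x ∷ xs) all≡false with p x in px
... | false = x , here refl , px
... | true  = let y , y∈ , py = allB-false⇒∃ p xs all≡false in y , there y∈ , py


Pr-chainFrom-suc : ∀ r (σ : Subset n) (E : List (Subset n) → Bool) →
  Pr (chainFrom (suc r) σ) E ≡ 𝔼 (uniform (deletions σ)) (λ τ → Pr (chainFrom r τ) (λ c → E (σ ∷ c)))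
Pr-chainFrom-suc r σ E = trans (Pr-bind (uniform (deletions σ)) _ E)
  (𝔼-cong (uniform (deletions σ)) (λ τ → Pr-map-cons σ _ (λ _ _ → refl) (chainFrom r τ) E))

Pr-chainFrom-head : ∀ r (σ : Subset n) (F : Subset n → Bool) {b} → F σ ≡ b →
  Pr (chainFrom r σ) (λ ω → F (nth ⊥ 0 ω)) ≡ Pr (chainFrom r σ) (λ _ → b)
Pr-chainFrom-head zero    σ F refl = refl
Pr-chainFrom-head (suc r) σ F refl = trans (Pr-chainFrom-suc r σ _) (sym (Pr-chainFrom-suc r σ _))

Pr-chainFrom-nonNeg : ∀ r (σ : Subset n) E → 0ℚ ≤ℚ Pr (chainFrom r σ) E
Pr-chainFrom-nonNeg zero σ E with E (σ ∷ [])
... | true  = ℚ.nonNegative⁻¹ _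
... | false = ℚ.≤-refl
Pr-chainFrom-nonNeg (suc r) σ E = subst (0ℚ ≤ℚ_) (sym (Pr-chainFrom-suc r σ E))
  (𝔼-nonNeg (uniform (deletions σ)) (uniform-supportedOn _ (deletions σ) (λ τ _ → Pr-chainFrom-nonNeg r τ _)))

-- The bound on r matters: a walk that runs out of vertices loses its mass, as uniform [] = [].
Pr-chainFrom-total : ∀ r (σ : Subset n) → r ≤ ∣ σ ∣ → Pr (chainFrom r σ) (λ _ → true) ≡ 1ℚ
Pr-chainFrom-total zero    σ _   = ℚ.+-identityʳ 1ℚ
Pr-chainFrom-total (suc r) σ r<∣σ∣ = trans (Pr-chainFrom-suc r σ _)
  (𝔼-uniform-ones (deletions σ) _ (subst (0 <_) (sym (length-deletions σ)) (ℕ.≤-trans (s≤s z≤n) r<∣σ∣))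
    (λ τ τ∈ → Pr-chainFrom-total r τ (ℕ.≤-pred (subst (suc r ≤_) (sym (∈-deletions⇒1+∣τ∣≡∣s∣ σ τ∈)) r<∣σ∣))))

Pr-chainFrom-suc-dominated : ∀ r (σ : Subset n) {E F : List (Subset n) → Bool} (c : ℚ) →
  (∀ τ → τ ∈ deletions σ → Pr (chainFrom r τ) (λ ω → E (σ ∷ ω)) ≤ℚ c * Pr (chainFrom r τ) (λ ω → F (σ ∷ ω))) →
  Pr (chainFrom (suc r) σ) E ≤ℚ c * Pr (chainFrom (suc r) σ) F
Pr-chainFrom-suc-dominated r σ c dom =
  subst₂ (λ x y → x ≤ℚ c * y) (sym (Pr-chainFrom-suc r σ _)) (sym (Pr-chainFrom-suc r σ _))
    (𝔼-dominated (uniform (deletions σ)) c (uniform-supportedOn _ (deletions σ) dom))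

facet-avoids-bound : ∀ m (C : Subset n → Bool) (τ : Subset n) → ∣ τ ∣ ≡ suc m →
  ∀ {ρ} → ρ ∈ deletions τ → C ρ ≡ false →
  1ℚ ≤ℚ (+ suc m) / 1 * Pr (chainFrom (suc m) τ) (λ ω → not (C (nth ⊥ 1 ω)))
facet-avoids-bound {n} m C τ ∣τ∣≡ {ρ} ρ∈ Cρ≡false = begin
  1ℚ                                                     ≡⟨ sym (Pr-chainFrom-total m ρ (ℕ.≤-reflexive (sym ∣ρ∣≡m))) ⟩
  Pr (chainFrom m ρ) (λ _ → true)                        ≡⟨ sym (Pr-chainFrom-head m ρ (λ ρ′ → not (C ρ′)) (cong not Cρ≡false)) ⟩
  avoid ρ                                                ≤⟨ ∑-≥-term avoid (deletions τ) (λ ρ′ _ → Pr-chainFrom-nonNeg m ρ′ _) ρ∈ ⟩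
  ∑ avoid (deletions τ)                                  ≡⟨ sym (length*𝔼-uniform m (deletions τ) avoid (trans (length-deletions τ) ∣τ∣≡)) ⟩
  (+ suc m) / 1 * 𝔼 (uniform (deletions τ)) avoid        ≡⟨ cong ((+ suc m) / 1 *_) (sym (Pr-chainFrom-suc m τ _)) ⟩
  (+ suc m) / 1 * Pr (chainFrom (suc m) τ) (λ ω → not (C (nth ⊥ 1 ω))) ∎
  where
  open ℚ.≤-Reasoning
  avoid : Subset n → ℚ
  avoid ρ′ = Pr (chainFrom m ρ′) (λ ω → not (C (nth ⊥ 0 ω)))
  ∣ρ∣≡m : ∣ ρ ∣ ≡ m
  ∣ρ∣≡m = ℕ.suc-injective (trans (∈-deletions⇒1+∣τ∣≡∣s∣ τ ρ∈) ∣τ∣≡)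


DefectWitnessed : (A B C : Subset n → Bool) → ℕ → Set
DefectWitnessed A B C m = ∀ {σ τ} → A σ ≡ true → τ ∈ deletions σ → B τ ≡ false →
  ∣ τ ∣ ≡ suc m × ∃[ ρ ] ρ ∈ deletions τ × C ρ ≡ false

module _ {A B C : Subset n → Bool} {m : ℕ} (witnessed : DefectWitnessed A B C m) where

  private
    K : ℚ
    K = (+ suc m) / 1

  defect-step : ∀ σ τ → τ ∈ deletions σ →
    Pr (chainFrom (suc m) τ) (λ ω → A σ ∧ not (B (nth ⊥ 0 ω)))
      ≤ℚ K * Pr (chainFrom (suc m) τ) (λ ω → A σ ∧ not (C (nth ⊥ 1 ω)))
  defect-step σ τ τ∈ with A σ in Aσ | B τ in Bτ
  ... | false | _     = ℚ.≤-reflexive (trans (Pr-false μ) (sym (trans (cong (K *_) (Pr-false μ)) (ℚ.*-zeroʳ K))))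
    where
    μ : Dist (List (Subset n))
    μ = chainFrom (suc m) τ
  ... | true  | true  = ℚ.≤-trans (ℚ.≤-reflexive (trans (Pr-chainFrom-head (suc m) τ (λ ρ → not (B ρ)) (cong not Bτ))
                                                      (Pr-false (chainFrom (suc m) τ))))
                                  (ℚ.nonNegative⁻¹ (K * Pr-C) {{ℚ.nonNeg*nonNeg⇒nonNeg K {{ℚ.nonNegative (k/1-nonNeg (suc m))}}
                                                                    Pr-C {{ℚ.nonNegative (Pr-chainFrom-nonNeg (suc m) τ _)}}}})
    where
    Pr-C : ℚ
    Pr-C = Pr (chainFrom (suc m) τ) (λ ω → not (C (nth ⊥ 1 ω)))
  ... | true  | false = ℚ.≤-trans (ℚ.≤-reflexive (trans (Pr-chainFrom-head (suc m) τ (λ ρ → not (B ρ)) (cong not Bτ))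
                                                      (Pr-chainFrom-total (suc m) τ (ℕ.≤-reflexive (sym ∣τ∣≡)))))
                                  (facet-avoids-bound m C τ ∣τ∣≡ ρ∈ Cρ)
    where
    ∣τ∣≡ : ∣ τ ∣ ≡ suc m
    ∣τ∣≡ = proj₁ (witnessed Aσ τ∈ Bτ)
    ρ : Subset n
    ρ = proj₁ (proj₂ (witnessed Aσ τ∈ Bτ))
    ρ∈ : ρ ∈ deletions τ
    ρ∈ = proj₁ (proj₂ (proj₂ (witnessed Aσ τ∈ Bτ)))
    Cρ : C ρ ≡ false
    Cρ = proj₂ (proj₂ (proj₂ (witnessed Aσ τ∈ Bτ)))

  chainFrom-defect-bound : ∀ j (σ : Subset n) →
    Pr (chainFrom (j + suc (suc m)) σ) (λ ω → A (nth ⊥ j ω) ∧ not (B (nth ⊥ (suc j) ω)))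
      ≤ℚ K * Pr (chainFrom (j + suc (suc m)) σ) (λ ω → A (nth ⊥ j ω) ∧ not (C (nth ⊥ (suc (suc j)) ω)))
  chainFrom-defect-bound zero    σ = Pr-chainFrom-suc-dominated (suc m) σ K (defect-step σ)
  chainFrom-defect-bound (suc j) σ = Pr-chainFrom-suc-dominated (j + suc (suc m)) σ K
                                       (λ τ _ → chainFrom-defect-bound j τ)

  process-defect-bound : ∀ (Y : Subset n → Bool) {T j p q} → T ≡ j + suc (suc m) → p ≡ suc j → q ≡ suc (suc j) →
    Pr (process Y T) (λ ω → A (nth ⊥ j ω) ∧ not (B (nth ⊥ p ω)))
      ≤ℚ K * Pr (process Y T) (λ ω → A (nth ⊥ j ω) ∧ not (C (nth ⊥ q ω)))
  process-defect-bound Y {j = j} refl refl refl =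
    Pr-bind-dominated (uniform (facesOfSize Y top)) (chainFrom top) K
      (uniform-supportedOn _ (facesOfSize Y top) (λ σ _ → chainFrom-defect-bound j σ))
    where
    top : ℕ
    top = j + suc (suc m)


full-defect-witnessed : ∀ (X : Family n) {d i η W} → IsPureComplex X d → ∀ m →
  DefectWitnessed (full X d i η W (suc (suc m))) (full X d i η W (suc m)) (fat X d i η W m) m
full-defect-witnessed X {d} {i} {η} {W} pc m {σ} {τ} σ-full τ∈ τ-notFull =
  ∣τ∣≡ , allB-false⇒∃ (fat X d i η W m) (deletions τ) facets-notFat
  where
  Xσ : X σ ≡ true
  Xσ = ∧-conicalˡ (X σ) _ σ-full
  ∣σ∣≡ : ∣ σ ∣ ≡ suc (suc m)
  ∣σ∣≡ = ℕ.≡ᵇ⇒≡ ∣ σ ∣ (suc (suc m)) (Equivalence.from T-≡ (∧-conicalˡ (∣ σ ∣ ≡ᵇ suc (suc m)) _ (∧-conicalʳ (X σ) _ σ-full)))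
  ∣τ∣≡ : ∣ τ ∣ ≡ suc m
  ∣τ∣≡ = ℕ.suc-injective (trans (∈-deletions⇒1+∣τ∣≡∣s∣ σ τ∈) ∣σ∣≡)
  Xτ : X τ ≡ true
  Xτ = IsPureComplex.downClosed pc σ τ (∈-deletions⇒⊆ σ τ∈) Xσ
  facets-notFat : allB (fat X d i η W m) (deletions τ) ≡ false
  facets-notFat = trans (sym (cong₂ (λ x y → x ∧ (y ∧ allB (fat X d i η W m) (deletions τ))) Xτ
                  (Equivalence.to T-≡ (ℕ.≡⇒≡ᵇ ∣ τ ∣ (suc m) ∣τ∣≡)))) τ-notFull

private
  ∸≡suc∸suc : ∀ {m d} → m < d → d ∸ m ≡ suc (d ∸ suc m)
  ∸≡suc∸suc (s≤s m≤d) = ℕ.+-∸-assoc 1 m≤d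

lemma2p12 : (n : ℕ) (X : Family n) (d i : ℕ) → IsPureComplex X d → i < d →
    (η : ℚ) → 0ℚ <ℚ η → η <ℚ 1ℚ →
    (W : Family n) → IsCochain X i W →
    (k : ℕ) → 1 ≤ k → k ≤ suc i →
    Pr (process X (suc d))
    (λ ω → full X d i η W (suc k) (Pat (suc d) (suc k) ω)
    ∧ not (full X d i η W k (Pat (suc d) k ω)))
    ≤ℚ ((+ k) / 1) * Pr (process X (suc d))
    (λ ω → full X d i η W (suc k) (Pat (suc d) (suc k) ω)
    ∧ not (fat X d i η W (k Data.Nat.∸ 1) (Pat (suc d) (k Data.Nat.∸ 1) ω)))
-- Only the downward closure of X enters.
lemma2p12 n X d i pc i<d η _ _ W _ (suc m) _ k≤1+i =
  process-defect-bound (full-defect-witnessed X pc m) X walk-length B-position C-position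
  where
  m<d : m < d
  m<d = ℕ.≤-trans k≤1+i i<d
  walk-length : suc d ≡ (d ∸ suc m) + suc (suc m)
  walk-length = sym (trans (ℕ.+-suc (d ∸ suc m) (suc m)) (cong suc (ℕ.m∸n+n≡m m<d)))
  B-position : d ∸ m ≡ suc (d ∸ suc m)
  B-position = ∸≡suc∸suc m<d
  C-position : suc d ∸ m ≡ suc (suc (d ∸ suc m))
  C-position = trans (ℕ.+-∸-assoc 1 (ℕ.<⇒≤ m<d)) (cong suc B-position)
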